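{- For any formulas $\phi,\psi$ of $\mathcal{L}^{\mathfrak{U}}$ (with free variables among $\vec x,\vec X$), $\mathbf{RCA_0}$ proves \[\forall U\,\forall\vec X\,\forall\vec x\,\big((U\Vdash\phi)\wedge(U\Vdash(\phi\rightarrow\psi))\rightarrow(U\Vdash\psi)\big).\]
   Context: $\mathcal{L}^2$ is the language of second-order arithmetic with terms $T_t$ ($s\in T_t\leftrightarrow (t,s)\in T$); $\mathcal{L}^{\mathfrak{U}}$ adds a unary predicate $\mathfrak{U}$ on second-order terms. For a set $U$, $U_n=\{s:(n,s)\in U\}$; $Ult(U)$: for every finite $F$, $\bigcap_{n\in F}U_n$ is infinite; $V\preceq U$: $Ult(V)$ and for every $n$ there is $m$ with $V_m\subseteq U_n$. Forcing $U\Vdash\phi$ (an $\mathcal{L}^2$-formula) is defined by recursion on $\phi$: atomic without $\mathfrak{U}$: $\phi$; $U\Vdash T\in\mathfrak{U}$: some finite $F$ has $\bigcap_{n\in F}U_n\setminus T$ finite; $\wedge$: conjunction of forcings; $U\Vdash\phi\vee\psi$: $\forall V\preceq U\,\exists W\preceq V\,(W\Vdash\phi\vee W\Vdash\psi)$; $U\Vdash\neg\phi$: $\forall V\preceq U\,\neg(V\Vdash\phi)$; $U\Vdash\phi\rightarrow\psi$: $\forall V\preceq U\,(V\Vdash\phi\rightarrow V\Vdash\psi)$; $U\Vdash\forall x\phi$: $\forall x\,(U\Vdash\phi)$; $U\Vdash\exists x\phi$: $\forall V\preceq U\,\exists W\preceq V\,\exists x\,(W\Vdash\phi)$; $\forall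 X,\exists X$ analogously with set quantifiers.
   Formalization: The quantifier ∀U ranges only over sets U with Ult(U), that is, sets for which $\bigcap_{n\in F}U_n$ is infinite for every finite F. The statement above fails without it. -}

module Defs where

-- Semantic rendering of "RCA_0 proves ...": the statement is asserted in every
-- (Henkin) L^2-structure satisfying the axioms of RCA_0, with classical
-- (Goedel-Gentzen negative translation) semantics of the object language.

open import Data.Nat using (ℕ; zero; suc)
open import Data.Product using (_×_; _,_)
open import Data.Empty using (⊥)
open import Relation.Nullary using (¬_)
open import Relation.Binary.PropositionalEquality using (_≡_)

data Tm : Set where
  var : ℕ → Tm
  `0  : Tm
  `1  : Tm
  _⊕_ : Tm → Tm → Tm
  _⊗_ : Tm → Tm → Tm

data STm : Set where
  svar : ℕ → STm
  sec  : STm → Tm → STm      -- sec T t  is  T_t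

data Fm : Set where
  _≐_  : Tm → Tm → Fm
  _≺_  : Tm → Tm → Fm
  _∈̇_  : Tm → STm → Fm
  𝔘    : STm → Fm
  _∧̇_  : Fm → Fm → Fm
  _∨̇_  : Fm → Fm → Fm
  _⇒_  : Fm → Fm → Fm
  ¬̇_   : Fm → Fm
  ∀̇    : Fm → Fm             -- binds number variable 0
  ∃̇    : Fm → Fm
  ∀S   : Fm → Fm             -- binds set variable 0
  ∃S   : Fm → Fm

wk : Tm → Tm
wk (var i) = var (suc i)
wk `0 = `0
wk `1 = `1
wk (s ⊕ t) = wk s ⊕ wk t
wk (s ⊗ t) = wk s ⊗ wk t

data Δ⁰₀ : Fm → Set where
  eq  : ∀ s t → Δ⁰₀ (s ≐ t)
  lt  : ∀ s t → Δ⁰₀ (s ≺ t)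
  mem : ∀ t T → Δ⁰₀ (t ∈̇ T)
  neg : ∀ {φ} → Δ⁰₀ φ → Δ⁰₀ (¬̇ φ)
  and : ∀ {φ ψ} → Δ⁰₀ φ → Δ⁰₀ ψ → Δ⁰₀ (φ ∧̇ ψ)
  or  : ∀ {φ ψ} → Δ⁰₀ φ → Δ⁰₀ ψ → Δ⁰₀ (φ ∨̇ ψ)
  imp : ∀ {φ ψ} → Δ⁰₀ φ → Δ⁰₀ ψ → Δ⁰₀ (φ ⇒ ψ)
  ball : ∀ t {θ} → Δ⁰₀ θ → Δ⁰₀ (∀̇ ((var 0 ≺ wk t) ⇒ θ))
  bex  : ∀ t {θ} → Δ⁰₀ θ → Δ⁰₀ (∃̇ ((var 0 ≺ wk t) ∧̇ θ))

data Σ⁰₁ : Fm → Set where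
  sig : ∀ {θ} → Δ⁰₀ θ → Σ⁰₁ (∃̇ θ)

data Π⁰₁ : Fm → Set where
  pi : ∀ {θ} → Δ⁰₀ θ → Π⁰₁ (∀̇ θ)

-- Classical connectives (negative translation)

∃ᶜ : {A : Set} → (A → Set) → Set
∃ᶜ {A} P = ¬ ((a : A) → ¬ P a)

_∨ᶜ_ : Set → Set → Set
A ∨ᶜ B = ¬ (¬ A × ¬ B)

_⇔_ : Set → Set → Set
A ⇔ B = (A → B) × (B → A)

ext : {A : Set} → A → (ℕ → A) → ℕ → A
ext a ρ zero = a
ext a ρ (suc i) = ρ i

record Structure : Set₁ where
  field
    M    : Set
    S    : Set
    z    : M
    o    : M
    _+_  : M → M → M
    _·_  : M → M → M
    _<_  : M → M → Set
    _∈_  : M → S → Set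

module Sem (𝓜 : Structure) where
  open Structure 𝓜

  -- stable atoms
  Eq : M → M → Set
  Eq a b = ¬ ¬ (a ≡ b)
  Lt : M → M → Set
  Lt a b = ¬ ¬ (a < b)
  Mem : M → S → Set
  Mem a X = ¬ ¬ (a ∈ X)

  pair : M → M → M
  pair i j = ((i + j) · (i + j)) + i

  ⟦_⟧ : Tm → (ℕ → M) → M
  ⟦ var i ⟧ ρ = ρ i
  ⟦ `0 ⟧ ρ = z
  ⟦ `1 ⟧ ρ = o
  ⟦ s ⊕ t ⟧ ρ = ⟦ s ⟧ ρ + ⟦ t ⟧ ρ
  ⟦ s ⊗ t ⟧ ρ = ⟦ s ⟧ ρ · ⟦ t ⟧ ρ

  -- membership in a second-order term:  s ∈ T_t  iff  (t,s) ∈ T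
  MemT : M → STm → (ℕ → M) → (ℕ → S) → Set
  MemT x (svar i) ρ σ = Mem x (σ i)
  MemT x (sec T t) ρ σ = MemT (pair (⟦ t ⟧ ρ) x) T ρ σ

  -- satisfaction of L^2 formulas (only used for 𝔘-free formulas, namely
  -- Σ⁰₁ / Π⁰₁ instances of the RCA_0 schemas; 𝔘 is given no meaning here)
  Sat : Fm → (ℕ → M) → (ℕ → S) → Set
  Sat (s ≐ t) ρ σ = Eq (⟦ s ⟧ ρ) (⟦ t ⟧ ρ)
  Sat (s ≺ t) ρ σ = Lt (⟦ s ⟧ ρ) (⟦ t ⟧ ρ)
  Sat (t ∈̇ T) ρ σ = MemT (⟦ t ⟧ ρ) T ρ σ
  Sat (𝔘 T) ρ σ = ⊥
  Sat (φ ∧̇ ψ) ρ σ = Sat φ ρ σ × Sat ψ ρ σ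
  Sat (φ ∨̇ ψ) ρ σ = Sat φ ρ σ ∨ᶜ Sat ψ ρ σ
  Sat (φ ⇒ ψ) ρ σ = Sat φ ρ σ → Sat ψ ρ σ
  Sat (¬̇ φ) ρ σ = ¬ Sat φ ρ σ
  Sat (∀̇ φ) ρ σ = (x : M) → Sat φ (ext x ρ) σ
  Sat (∃̇ φ) ρ σ = ∃ᶜ λ (x : M) → Sat φ (ext x ρ) σ
  Sat (∀S φ) ρ σ = (X : S) → Sat φ ρ (ext X σ)
  Sat (∃S φ) ρ σ = ∃ᶜ λ (X : S) → Sat φ ρ (ext X σ)

  -- a set of numbers (given by a predicate) is finite = bounded
  Finite : (M → Set) → Set
  Finite P = ∃ᶜ λ (b : M) → (s : M) → P s → Lt s b

  Infinite : (M → Set) → Set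
  Infinite P = ¬ Finite P

  FinSet : S → Set
  FinSet F = Finite (λ n → Mem n F)

  -- s ∈ ⋂_{n ∈ F} U_n
  Inter : S → S → M → Set
  Inter U F s = (n : M) → Mem n F → Mem (pair n s) U

  Ult : S → Set
  Ult U = (F : S) → FinSet F → Infinite (Inter U F)

  _⪯_ : S → S → Set
  V ⪯ U = Ult V × ((n : M) → ∃ᶜ λ (m : M) →
            (s : M) → Mem (pair m s) V → Mem (pair n s) U)

  Forces : S → Fm → (ℕ → M) → (ℕ → S) → Set
  Forces U (s ≐ t) ρ σ = Sat (s ≐ t) ρ σ
  Forces U (s ≺ t) ρ σ = Sat (s ≺ t) ρ σ
  Forces U (t ∈̇ T) ρ σ = Sat (t ∈̇ T) ρ σ
  Forces U (𝔘 T) ρ σ = ∃ᶜ λ (F : S) → FinSet F ×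
    Finite (λ s → Inter U F s × ¬ MemT s T ρ σ)
  Forces U (φ ∧̇ ψ) ρ σ = Forces U φ ρ σ × Forces U ψ ρ σ
  Forces U (φ ∨̇ ψ) ρ σ = (V : S) → V ⪯ U → ∃ᶜ λ (W : S) → W ⪯ V ×
    (Forces W φ ρ σ ∨ᶜ Forces W ψ ρ σ)
  Forces U (¬̇ φ) ρ σ = (V : S) → V ⪯ U → ¬ Forces V φ ρ σ
  Forces U (φ ⇒ ψ) ρ σ = (V : S) → V ⪯ U → Forces V φ ρ σ → Forces V ψ ρ σ
  Forces U (∀̇ φ) ρ σ = (x : M) → Forces U φ (ext x ρ) σ
  Forces U (∃̇ φ) ρ σ = (V : S) → V ⪯ U → ∃ᶜ λ (W : S) → W ⪯ V ×
    ∃ᶜ λ (x : M) → Forces W φ (ext x ρ) σ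
  Forces U (∀S φ) ρ σ = (X : S) → Forces U φ ρ (ext X σ)
  Forces U (∃S φ) ρ σ = (V : S) → V ⪯ U → ∃ᶜ λ (W : S) → W ⪯ V ×
    ∃ᶜ λ (X : S) → Forces W φ ρ (ext X σ)

record IsRCA₀ (𝓜 : Structure) : Set₁ where
  open Structure 𝓜
  open Sem 𝓜
  field
    ax1 : (n : M) → ¬ Eq (n + o) z
    ax2 : (m n : M) → Eq (m + o) (n + o) → Eq m n
    ax3 : (m : M) → Eq (m + z) m
    ax4 : (m n : M) → Eq (m + (n + o)) ((m + n) + o)
    ax5 : (m : M) → Eq (m · z) z
    ax6 : (m n : M) → Eq (m · (n + o)) ((m · n) + m)
    ax7 : (m : M) → ¬ Lt m z
    ax8 : (m n : M) → Lt m (n + o) ⇔ (Lt m n ∨ᶜ Eq m n)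
    Σ⁰₁-ind : (φ : Fm) → Σ⁰₁ φ → (ρ : ℕ → M) (σ : ℕ → S) →
      Sat φ (ext z ρ) σ →
      ((x : M) → Sat φ (ext x ρ) σ → Sat φ (ext (x + o) ρ) σ) →
      (x : M) → Sat φ (ext x ρ) σ
    Δ⁰₁-comp : (φ ψ : Fm) → Σ⁰₁ φ → Π⁰₁ ψ → (ρ : ℕ → M) (σ : ℕ → S) →
      ((x : M) → Sat φ (ext x ρ) σ ⇔ Sat ψ (ext x ρ) σ) →
      ∃ᶜ λ (X : S) → (x : M) → Mem x X ⇔ Sat φ (ext x ρ) σ

{-# OPTIONS --safe #-}
module Submission where

open import Defs
open import Data.Nat using (ℕ)
open import Data.Product using (_,_)

module _ (𝓜 : Structure) where
  open Structure 𝓜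
  open Sem 𝓜

  ⪯-refl : {U : S} → Ult U → U ⪯ U
  ⪯-refl ult = ult , λ n noWitness → noWitness n (λ s s∈Uₙ → s∈Uₙ)

  forces-modusPonens : {U : S} → Ult U → (φ ψ : Fm) (ρ : ℕ → M) (σ : ℕ → S) →
    Forces U φ ρ σ → Forces U (φ ⇒ ψ) ρ σ → Forces U ψ ρ σ
  forces-modusPonens ult φ ψ ρ σ U⊩φ U⊩φ⇒ψ = U⊩φ⇒ψ _ (⪯-refl ult) U⊩φ

mainTheorem9 : (𝓜 : Structure) → IsRCA₀ 𝓜 → (φ ψ : Fm) →
    (U : Structure.S 𝓜) → (σ : ℕ → Structure.S 𝓜) → (ρ : ℕ → Structure.M 𝓜) →
    Sem.Ult 𝓜 U →
    Sem.Forces 𝓜 U φ ρ σ → Sem.Forces 𝓜 U (φ ⇒ ψ) ρ σ → Sem.Forces 𝓜 U ψ ρ σ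
mainTheorem9 𝓜 _ φ ψ U σ ρ ult =
  forces-modusPonens 𝓜 ult φ ψ ρ σ
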